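{- Let $M=(E,G)$ be a triangle-free matroid with no induced $I_3$-restriction. Then $(E,\mathrm{cl}(E))$ is an affine geometry.
   Context: A simple binary matroid (here just "matroid") is a pair $M=(E,G)$, where $G$ is identified with $\mathbb F_2^n\setminus\{0\}$ and $E\subseteq G$. A flat of $G$ is a set $V\setminus\{0\}$ with $V$ a subspace, of dimension $\dim V$; a triangle is a flat of dimension $2$ (three distinct nonzero vectors summing to $0$), and a hyperplane of a flat $F$ is a flat of dimension $\dim F-1$ contained in it. $\mathrm{cl}(E)$ is the smallest flat containing $E$. $M$ is triangle-free if $E$ contains no triangle. $M$ has an induced $I_3$-restriction if there is a $3$-dimensional flat $P$ with $E\cap P$ consisting of $3$ linearly independent vectors. An affine geometry is a matroid $(F\setminus H,F)$ where $F$ is a flat and $H$ a hyperplane of $F$. -}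

module Defs where

open import Data.Bool using (Bool; true; false; _xor_)
open import Data.Nat using (ℕ; suc)
open import Data.Vec using (Vec; []; _∷_; zipWith; replicate)
open import Data.Product using (Σ; ∃; _×_; _,_)
open import Data.Sum using (_⊎_)
open import Relation.Nullary using (¬_)
open import Relation.Binary.PropositionalEquality using (_≡_; _≢_)
open import Level using (0ℓ)
open import Relation.Unary using (Pred)

𝔽₂^ : ℕ → Set
𝔽₂^ n = Vec Bool n

VSet : ℕ → Set₁
VSet n = Pred (𝔽₂^ n) 0ℓ

0v : ∀ {n} → 𝔽₂^ n
0v {n} = replicate n false

infixl 6 _⊕_
_⊕_ : ∀ {n} → 𝔽₂^ n → 𝔽₂^ n → 𝔽₂^ n
_⊕_ = zipWith _xor_

lincomb : ∀ {n d} → Vec (𝔽₂^ n) d → Vec Bool d → 𝔽₂^ n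
lincomb []       []          = 0v
lincomb (b ∷ bs) (true ∷ c)  = b ⊕ lincomb bs c
lincomb (b ∷ bs) (false ∷ c) = lincomb bs c

LinIndep : ∀ {n d} → Vec (𝔽₂^ n) d → Set
LinIndep {n} {d} B = ∀ (c : Vec Bool d) → lincomb B c ≡ 0v → c ≡ replicate d false

-- S is a flat of dimension d: S = V ∖ {0} for the subspace V spanned by
-- some d linearly independent vectors (i.e. V has a basis of size d).
FlatDim : ∀ {n} → VSet n → ℕ → Set
FlatDim {n} S d =
  Σ (Vec (𝔽₂^ n) d) λ B → LinIndep B ×
    (∀ v → (S v → (v ≢ 0v × ∃ λ c → lincomb B c ≡ v))
         × ((v ≢ 0v × ∃ λ c → lincomb B c ≡ v) → S v))

IsFlat : ∀ {n} → VSet n → Set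
IsFlat S = ∃ λ d → FlatDim S d

_⊆_ : ∀ {n} → VSet n → VSet n → Set
A ⊆ B = ∀ v → A v → B v

-- A simple binary matroid (E, G) with G = 𝔽₂ⁿ ∖ {0}: E ⊆ G.
IsGroundSubset : ∀ {n} → VSet n → Set
IsGroundSubset E = ∀ v → E v → v ≢ 0v

-- Triangle: flat of dimension 2.  Triangle-free: E contains no triangle.
TriangleFree : ∀ {n} → VSet n → Set₁
TriangleFree E = ∀ T → FlatDim T 2 → ¬ (T ⊆ E)

HasInducedI3 : ∀ {n} → VSet n → Set₁
HasInducedI3 {n} E =
  Σ (VSet n) λ P → FlatDim P 3 ×
    Σ (𝔽₂^ n) λ a → Σ (𝔽₂^ n) λ b → Σ (𝔽₂^ n) λ c →
      LinIndep (a ∷ b ∷ c ∷ []) ×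
      (∀ v → ((E v × P v) → (v ≡ a ⊎ v ≡ b ⊎ v ≡ c))
           × ((v ≡ a ⊎ v ≡ b ⊎ v ≡ c) → (E v × P v)))

IsClosure : ∀ {n} → VSet n → VSet n → Set₁
IsClosure {n} E F = IsFlat F × E ⊆ F × (∀ (F' : VSet n) → IsFlat F' → E ⊆ F' → F ⊆ F')

IsAffineGeometry : ∀ {n} → VSet n → VSet n → Set₁
IsAffineGeometry {n} E F =
  Σ ℕ λ k → FlatDim F (suc k) ×
    Σ (VSet n) λ H → FlatDim H k × H ⊆ F ×
      (∀ v → (E v → (F v × ¬ H v)) × ((F v × ¬ H v) → E v))

-- Triangle-freeness says that a ⊕ b ∉ E for distinct a, b ∈ E.  If moreover
-- a ⊕ b ⊕ c ∉ E for pairwise distinct a, b, c ∈ E, then E meets the flat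
-- spanned by a, b, c in exactly {a, b, c}, an induced I₃.  Hence E is closed
-- under sums of three elements, so for any e₀ ∈ E the translate e₀ ⊕ E is a
-- subspace W not containing e₀.  With a basis B of W, E = e₀ ⊕ W is the
-- complement of the hyperplane span B in the flat span (e₀ ∷ B) = cl(E).
module Submission where

open import Defs
open import Data.Nat using (ℕ; zero; suc)
open import Data.Product using (Σ; ∃; _×_; _,_; proj₁; proj₂)
open import Data.Sum using (_⊎_; inj₁; inj₂)
open import Data.Bool using (Bool; true; false)
open import Data.Bool.Properties
  using (xor-assoc; xor-comm; xor-same; xor-identityˡ; xor-identityʳ)
  renaming (_≟_ to _≟ᵇ_)
open import Data.Vec using (Vec; []; _∷_; replicate)
open import Data.Vec.Properties
  using (zipWith-assoc; zipWith-comm; zipWith-identityˡ; zipWith-identityʳ; zipWith-inverseˡ; map-id; ≡-dec)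
open import Data.Fin.Subset.Properties using (anySubset?)
open import Data.List using (List; []; _∷_; _++_; map)
open import Data.List.Membership.Propositional using (_∈_)
open import Data.List.Membership.Propositional.Properties using (∈-++⁺ˡ; ∈-++⁺ʳ; ∈-map⁺)
open import Data.List.Relation.Unary.Any using (here; there)
open import Data.Empty using (⊥-elim)
open import Function using (id; _∘′_)
open import Relation.Nullary using (¬_; Dec; yes; no)
open import Relation.Unary using (Decidable)
open import Relation.Binary.PropositionalEquality

private
  variable
    n d : ℕ

⊕-assoc : (x y z : 𝔽₂^ n) → (x ⊕ y) ⊕ z ≡ x ⊕ (y ⊕ z)
⊕-assoc = zipWith-assoc xor-assoc

⊕-comm : (x y : 𝔽₂^ n) → x ⊕ y ≡ y ⊕ x
⊕-comm = zipWith-comm xor-comm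

⊕-identityˡ : (x : 𝔽₂^ n) → 0v ⊕ x ≡ x
⊕-identityˡ = zipWith-identityˡ xor-identityˡ

⊕-identityʳ : (x : 𝔽₂^ n) → x ⊕ 0v ≡ x
⊕-identityʳ = zipWith-identityʳ xor-identityʳ

⊕-self : (x : 𝔽₂^ n) → x ⊕ x ≡ 0v
⊕-self x = trans (cong (_⊕ x) (sym (map-id x))) (zipWith-inverseˡ xor-same x)

⊕-cancelˡ : (x y : 𝔽₂^ n) → x ⊕ (x ⊕ y) ≡ y
⊕-cancelˡ x y = begin
  x ⊕ (x ⊕ y)  ≡⟨ ⊕-assoc x x y ⟨
  (x ⊕ x) ⊕ y  ≡⟨ cong (_⊕ y) (⊕-self x) ⟩
  0v ⊕ y       ≡⟨ ⊕-identityˡ y ⟩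
  y            ∎
  where open ≡-Reasoning

⊕-cancelʳ : (x y : 𝔽₂^ n) → (x ⊕ y) ⊕ y ≡ x
⊕-cancelʳ x y = trans (⊕-assoc x y y) (trans (cong (x ⊕_) (⊕-self y)) (⊕-identityʳ x))

⊕-swapˡ : (x y z : 𝔽₂^ n) → x ⊕ (y ⊕ z) ≡ y ⊕ (x ⊕ z)
⊕-swapˡ x y z = trans (sym (⊕-assoc x y z)) (trans (cong (_⊕ z) (⊕-comm x y)) (⊕-assoc y x z))

⊕≡0⇒≡ : {x y : 𝔽₂^ n} → x ⊕ y ≡ 0v → x ≡ y
⊕≡0⇒≡ {x = x} {y} p = begin
  x             ≡⟨ ⊕-identityʳ x ⟨
  x ⊕ 0v        ≡⟨ cong (x ⊕_) p ⟨
  x ⊕ (x ⊕ y)   ≡⟨ ⊕-cancelˡ x y ⟩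
  y             ∎
  where open ≡-Reasoning

_≟_ : (x y : 𝔽₂^ n) → Dec (x ≡ y)
_≟_ = ≡-dec _≟ᵇ_

Span : Vec (𝔽₂^ n) d → VSet n
Span B v = ∃ λ c → lincomb B c ≡ v

NonzeroSpan : Vec (𝔽₂^ n) d → VSet n
NonzeroSpan B v = v ≢ 0v × Span B v

lincomb-⊕ : (B : Vec (𝔽₂^ n) d) (c c′ : Vec Bool d) →
            lincomb B c ⊕ lincomb B c′ ≡ lincomb B (c ⊕ c′)
lincomb-⊕ []      []          []           = ⊕-self 0v
lincomb-⊕ (x ∷ B) (true ∷ c)  (true ∷ c′)  = begin
  (x ⊕ lincomb B c) ⊕ (x ⊕ lincomb B c′)  ≡⟨ ⊕-assoc x _ _ ⟩
  x ⊕ (lincomb B c ⊕ (x ⊕ lincomb B c′))  ≡⟨ cong (x ⊕_) (⊕-swapˡ _ x _) ⟩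
  x ⊕ (x ⊕ (lincomb B c ⊕ lincomb B c′))  ≡⟨ ⊕-cancelˡ x _ ⟩
  lincomb B c ⊕ lincomb B c′              ≡⟨ lincomb-⊕ B c c′ ⟩
  lincomb B (c ⊕ c′)                      ∎
  where open ≡-Reasoning
lincomb-⊕ (x ∷ B) (true ∷ c)  (false ∷ c′) = trans (⊕-assoc x _ _) (cong (x ⊕_) (lincomb-⊕ B c c′))
lincomb-⊕ (x ∷ B) (false ∷ c) (true ∷ c′)  = trans (⊕-swapˡ _ x _) (cong (x ⊕_) (lincomb-⊕ B c c′))
lincomb-⊕ (x ∷ B) (false ∷ c) (false ∷ c′) = lincomb-⊕ B c c′

lincomb-0 : (B : Vec (𝔽₂^ n) d) → lincomb B (replicate d false) ≡ 0v
lincomb-0 []      = refl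
lincomb-0 (x ∷ B) = lincomb-0 B

Span-⊕ : (B : Vec (𝔽₂^ n) d) {x y : 𝔽₂^ n} → Span B x → Span B y → Span B (x ⊕ y)
Span-⊕ B (c , refl) (c′ , refl) = c ⊕ c′ , sym (lincomb-⊕ B c c′)

Span-∷ : (x : 𝔽₂^ n) (B : Vec (𝔽₂^ n) d) {v : 𝔽₂^ n} → Span B v → Span (x ∷ B) v
Span-∷ x B (c , p) = false ∷ c , p

Span-head : (x : 𝔽₂^ n) (B : Vec (𝔽₂^ n) d) → Span (x ∷ B) x
Span-head x B = true ∷ replicate _ false , trans (cong (x ⊕_) (lincomb-0 B)) (⊕-identityʳ x)

-- A coefficient vector Vec Bool d is a Subset d, so anySubset? searches all of them.
Span? : (B : Vec (𝔽₂^ n) d) → Decidable (Span B)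
Span? B v = anySubset? (λ c → lincomb B c ≟ v)

LinIndep-∷ : {x : 𝔽₂^ n} {B : Vec (𝔽₂^ n) d} → LinIndep B → ¬ Span B x → LinIndep (x ∷ B)
LinIndep-∷ indep x∉B (true ∷ c)  p = ⊥-elim (x∉B (c , sym (⊕≡0⇒≡ p)))
LinIndep-∷ indep x∉B (false ∷ c) p = cong (false ∷_) (indep c p)

NonzeroSpan-flat : (B : Vec (𝔽₂^ n) d) → LinIndep B → FlatDim (NonzeroSpan B) d
NonzeroSpan-flat B indep = B , indep , λ v → id , id

flat-⊕-closed : {S : VSet n} → FlatDim S d → {x y : 𝔽₂^ n} →
                S x → S y → x ⊕ y ≢ 0v → S (x ⊕ y)
flat-⊕-closed (B , _ , S⇔) {x} {y} Sx Sy x⊕y≢0 =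
  proj₂ (S⇔ (x ⊕ y)) (x⊕y≢0 , Span-⊕ B (proj₂ (proj₁ (S⇔ x) Sx)) (proj₂ (proj₁ (S⇔ y) Sy)))

independent₂ : {a b : 𝔽₂^ n} → a ≢ 0v → b ≢ 0v → a ≢ b → LinIndep (a ∷ b ∷ [])
independent₂ a≢0 b≢0 a≢b (false ∷ false ∷ []) p = refl
independent₂ a≢0 b≢0 a≢b (true  ∷ false ∷ []) p = ⊥-elim (a≢0 (trans (sym (⊕-identityʳ _)) p))
independent₂ a≢0 b≢0 a≢b (false ∷ true  ∷ []) p = ⊥-elim (b≢0 (trans (sym (⊕-identityʳ _)) p))
independent₂ a≢0 b≢0 a≢b (true  ∷ true  ∷ []) p = ⊥-elim (a≢b (trans (⊕≡0⇒≡ p) (⊕-identityʳ _)))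

independent₃ : {a b c : 𝔽₂^ n} → LinIndep (b ∷ c ∷ []) →
               a ≢ 0v → a ≢ b → a ≢ c → a ≢ b ⊕ c → LinIndep (a ∷ b ∷ c ∷ [])
independent₃ {a = a} {b} {c} bc-indep a≢0 a≢b a≢c a≢b⊕c = LinIndep-∷ bc-indep a∉bc
  where
  a∉bc : ¬ Span (b ∷ c ∷ []) a
  a∉bc (false ∷ false ∷ [] , p) = a≢0 (sym p)
  a∉bc (true  ∷ false ∷ [] , p) = a≢b (trans (sym p) (⊕-identityʳ b))
  a∉bc (false ∷ true  ∷ [] , p) = a≢c (trans (sym p) (⊕-identityʳ c))
  a∉bc (true  ∷ true  ∷ [] , p) = a≢b⊕c (trans (sym p) (cong (b ⊕_) (⊕-identityʳ c)))

vectors : ∀ n → List (𝔽₂^ n)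
vectors zero    = [] ∷ []
vectors (suc n) = map (true ∷_) (vectors n) ++ map (false ∷_) (vectors n)

∈-vectors : (v : 𝔽₂^ n) → v ∈ vectors n
∈-vectors []          = here refl
∈-vectors (true ∷ v)  = ∈-++⁺ˡ (∈-map⁺ (true ∷_) (∈-vectors v))
∈-vectors {suc n} (false ∷ v) = ∈-++⁺ʳ (map (true ∷_) (vectors n)) (∈-map⁺ (false ∷_) (∈-vectors v))

IsSubspace : VSet n → Set
IsSubspace W = W 0v × (∀ {x y} → W x → W y → W (x ⊕ y))

record IndependentIn {n} (W : VSet n) : Set where
  constructor independentIn
  field
    {dim}       : ℕ
    basis       : Vec (𝔽₂^ n) dim
    independent : LinIndep basis
    span⊆      : ∀ c → W (lincomb basis c)
open IndependentIn

_⊑_ : {W : VSet n} → IndependentIn W → IndependentIn W → Set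
s ⊑ t = ∀ v → Span (basis s) v → Span (basis t) v

module _ {W : VSet n} (W? : Decidable W) (W-sub : IsSubspace W) where

  extend : (s : IndependentIn W) (u : 𝔽₂^ n) →
           Σ (IndependentIn W) λ t → s ⊑ t × (W u → Span (basis t) u)
  extend s u with W? u | Span? (basis s) u
  ... | no ¬Wu | _       = s , (λ _ → id) , λ Wu → ⊥-elim (¬Wu Wu)
  ... | yes _  | yes u∈s = s , (λ _ → id) , λ _ → u∈s
  ... | yes Wu | no u∉s  =
    independentIn (u ∷ basis s) (LinIndep-∷ (independent s) u∉s) span⊆′ ,
    (λ _ → Span-∷ u (basis s)) , λ _ → Span-head u (basis s)
    where
    span⊆′ : ∀ c → W (lincomb (u ∷ basis s) c)
    span⊆′ (true ∷ c)  = proj₂ W-sub Wu (span⊆ s c)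
    span⊆′ (false ∷ c) = span⊆ s c

  extendAll : (s : IndependentIn W) (us : List (𝔽₂^ n)) →
              Σ (IndependentIn W) λ t → s ⊑ t × (∀ {u} → u ∈ us → W u → Span (basis t) u)
  extendAll s []       = s , (λ _ → id) , λ ()
  extendAll s (u ∷ us) with extend s u
  ... | t , s⊑t , covers-u with extendAll t us
  ...   | r , t⊑r , covers-us = r , (λ v → t⊑r v ∘′ s⊑t v) , λ
    { (here refl) Wu → t⊑r u (covers-u Wu)
    ; (there u∈us)   → covers-us u∈us
    }

  subspace-basis : Σ (IndependentIn W) λ B → ∀ v → W v → Span (basis B) v
  subspace-basis =
    let B , _ , covers = extendAll empty (vectors n) in B , λ v → covers (∈-vectors v)
    where
    empty : IndependentIn W
    empty = independentIn [] (λ { [] _ → refl }) (λ { [] → proj₁ W-sub })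

Sum₃Closed : VSet n → Set
Sum₃Closed E = ∀ {a b c} → E a → E b → E c → E ((a ⊕ b) ⊕ c)

module _ {E : VSet n} (E? : Decidable E) (E⊆G : IsGroundSubset E) (sum₃ : Sum₃Closed E)
         {e₀ : 𝔽₂^ n} (Ee₀ : E e₀) where

  private
    W : VSet n
    W v = E (e₀ ⊕ v)

    W-subspace : IsSubspace W
    W-subspace = subst E (sym (⊕-identityʳ e₀)) Ee₀ , λ {x} {y} Wx Wy → subst E (sum≡ x y) (sum₃ Wx Ee₀ Wy)
      where
      sum≡ : ∀ x y → ((e₀ ⊕ x) ⊕ e₀) ⊕ (e₀ ⊕ y) ≡ e₀ ⊕ (x ⊕ y)
      sum≡ x y = begin
        ((e₀ ⊕ x) ⊕ e₀) ⊕ (e₀ ⊕ y)  ≡⟨ cong (λ z → (z ⊕ e₀) ⊕ (e₀ ⊕ y)) (⊕-comm e₀ x) ⟩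
        ((x ⊕ e₀) ⊕ e₀) ⊕ (e₀ ⊕ y)  ≡⟨ cong (_⊕ (e₀ ⊕ y)) (⊕-cancelʳ x e₀) ⟩
        x ⊕ (e₀ ⊕ y)                ≡⟨ ⊕-swapˡ x e₀ y ⟩
        e₀ ⊕ (x ⊕ y)                ∎
        where open ≡-Reasoning

    basisW : Σ (IndependentIn W) λ B → ∀ v → W v → Span (basis B) v
    basisW = subspace-basis (λ v → E? (e₀ ⊕ v)) W-subspace

    B : Vec (𝔽₂^ n) (dim (proj₁ basisW))
    B = basis (proj₁ basisW)

    F H : VSet n
    F = NonzeroSpan (e₀ ∷ B)
    H = NonzeroSpan B

    W-basis : ∀ c → W (lincomb B c)
    W-basis = span⊆ (proj₁ basisW)

    W⊆Span : ∀ v → W v → Span B v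
    W⊆Span = proj₂ basisW

    e₀∉Span : ¬ Span B e₀
    e₀∉Span (c , p) = E⊆G 0v (subst E (⊕-self e₀) (subst W p (W-basis c))) refl

    E-translate : ∀ {v} → E v → Span B (e₀ ⊕ v)
    E-translate {v} Ev = W⊆Span (e₀ ⊕ v) (subst E (sym (⊕-cancelˡ e₀ v)) Ev)

    H-translate : ∀ {v} → H v → E (e₀ ⊕ v)
    H-translate (_ , c , p) = subst W p (W-basis c)

    E⊆F : E ⊆ F
    E⊆F v Ev with E-translate Ev
    ... | c , p = E⊆G v Ev , true ∷ c , trans (cong (e₀ ⊕_) p) (⊕-cancelˡ e₀ v)

    E∩H-empty : ∀ {v} → E v → ¬ H v
    E∩H-empty {v} Ev (_ , v∈B) = e₀∉Span (subst (Span B) (⊕-cancelʳ e₀ v) (Span-⊕ B (E-translate Ev) v∈B))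

    F⊆E∪H : ∀ {v} → F v → E v ⊎ H v
    F⊆E∪H (_   , true ∷ c  , p) = inj₁ (subst E p (W-basis c))
    F⊆E∪H (v≢0 , false ∷ c , p) = inj₂ (v≢0 , c , p)

    F-minimal : ∀ (F′ : VSet n) → IsFlat F′ → E ⊆ F′ → F ⊆ F′
    F-minimal F′ (_ , F′-flat) E⊆F′ v Fv with F⊆E∪H Fv
    ... | inj₁ Ev = E⊆F′ v Ev
    ... | inj₂ Hv = subst F′ (⊕-cancelˡ e₀ v)
      (flat-⊕-closed F′-flat (E⊆F′ e₀ Ee₀) (E⊆F′ _ (H-translate Hv))
        (subst (_≢ 0v) (sym (⊕-cancelˡ e₀ v)) (proj₁ Fv)))

    F∖H⊆E : ∀ {v} → F v → ¬ H v → E v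
    F∖H⊆E Fv ¬Hv with F⊆E∪H Fv
    ... | inj₁ Ev = Ev
    ... | inj₂ Hv = ⊥-elim (¬Hv Hv)

    F-flat : FlatDim F (suc _)
    F-flat = NonzeroSpan-flat (e₀ ∷ B) (LinIndep-∷ (independent (proj₁ basisW)) e₀∉Span)

    H-flat : FlatDim H _
    H-flat = NonzeroSpan-flat B (independent (proj₁ basisW))

    H⊆F : H ⊆ F
    H⊆F v (v≢0 , v∈B) = v≢0 , Span-∷ e₀ B v∈B

  sum₃-closed⇒affine : Σ (VSet n) λ F → IsClosure E F × IsAffineGeometry E F
  sum₃-closed⇒affine =
    F , ((_ , F-flat) , E⊆F , F-minimal) ,
    (_ , F-flat , H , H-flat , H⊆F , λ v → (λ Ev → E⊆F v Ev , E∩H-empty Ev) , λ (Fv , ¬Hv) → F∖H⊆E Fv ¬Hv)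

module _ {E : VSet n} (E⊆G : IsGroundSubset E) (triangle-free : TriangleFree E) where

  sum₂∉ : ∀ {a b} → E a → E b → a ≢ b → ¬ E (a ⊕ b)
  sum₂∉ {a} {b} Ea Eb a≢b Ea⊕b =
    triangle-free _ (NonzeroSpan-flat (a ∷ b ∷ []) (independent₂ (E⊆G a Ea) (E⊆G b Eb) a≢b)) T⊆E
    where
    T⊆E : NonzeroSpan (a ∷ b ∷ []) ⊆ E
    T⊆E v (v≢0 , false ∷ false ∷ [] , p) = ⊥-elim (v≢0 (sym p))
    T⊆E v (_   , true  ∷ false ∷ [] , p) = subst E (trans (sym (⊕-identityʳ a)) p) Ea
    T⊆E v (_   , false ∷ true  ∷ [] , p) = subst E (trans (sym (⊕-identityʳ b)) p) Eb
    T⊆E v (_   , true  ∷ true  ∷ [] , p) = subst E (trans (cong (a ⊕_) (sym (⊕-identityʳ b))) p) Ea⊕b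

  inducedI3 : ∀ {a b c} → E a → E b → E c → a ≢ b → a ≢ c → b ≢ c →
              ¬ E ((a ⊕ b) ⊕ c) → HasInducedI3 E
  inducedI3 {a} {b} {c} Ea Eb Ec a≢b a≢c b≢c ¬Ea⊕b⊕c =
    P , NonzeroSpan-flat (a ∷ b ∷ c ∷ []) abc-indep , a , b , c , abc-indep , λ v → E∩P⊆abc v , abc⊆E∩P v
    where
    P : VSet _
    P = NonzeroSpan (a ∷ b ∷ c ∷ [])

    abc-indep : LinIndep (a ∷ b ∷ c ∷ [])
    abc-indep = independent₃ (independent₂ (E⊆G b Eb) (E⊆G c Ec) b≢c) (E⊆G a Ea) a≢b a≢c
                  (λ a≡b⊕c → sum₂∉ Eb Ec b≢c (subst E a≡b⊕c Ea))

    E∩P⊆abc : ∀ v → E v × P v → v ≡ a ⊎ v ≡ b ⊎ v ≡ c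
    E∩P⊆abc v (_  , v≢0 , false ∷ false ∷ false ∷ [] , p) = ⊥-elim (v≢0 (sym p))
    E∩P⊆abc v (_  , _   , true  ∷ false ∷ false ∷ [] , p) = inj₁ (trans (sym p) (⊕-identityʳ a))
    E∩P⊆abc v (_  , _   , false ∷ true  ∷ false ∷ [] , p) = inj₂ (inj₁ (trans (sym p) (⊕-identityʳ b)))
    E∩P⊆abc v (_  , _   , false ∷ false ∷ true  ∷ [] , p) = inj₂ (inj₂ (trans (sym p) (⊕-identityʳ c)))
    E∩P⊆abc v (Ev , _   , true  ∷ true  ∷ false ∷ [] , p) =
      ⊥-elim (sum₂∉ Ea Eb a≢b (subst E (trans (sym p) (cong (a ⊕_) (⊕-identityʳ b))) Ev))
    E∩P⊆abc v (Ev , _   , true  ∷ false ∷ true  ∷ [] , p) =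
      ⊥-elim (sum₂∉ Ea Ec a≢c (subst E (trans (sym p) (cong (a ⊕_) (⊕-identityʳ c))) Ev))
    E∩P⊆abc v (Ev , _   , false ∷ true  ∷ true  ∷ [] , p) =
      ⊥-elim (sum₂∉ Eb Ec b≢c (subst E (trans (sym p) (cong (b ⊕_) (⊕-identityʳ c))) Ev))
    E∩P⊆abc v (Ev , _   , true  ∷ true  ∷ true  ∷ [] , p) =
      ⊥-elim (¬Ea⊕b⊕c (subst E (trans (sym p) (trans (cong (λ z → a ⊕ (b ⊕ z)) (⊕-identityʳ c)) (sym (⊕-assoc a b c)))) Ev))

    abc⊆E∩P : ∀ v → v ≡ a ⊎ v ≡ b ⊎ v ≡ c → E v × P v
    abc⊆E∩P v (inj₁ refl)        = Ea , E⊆G a Ea , true ∷ false ∷ false ∷ [] , ⊕-identityʳ a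
    abc⊆E∩P v (inj₂ (inj₁ refl)) = Eb , E⊆G b Eb , false ∷ true ∷ false ∷ [] , ⊕-identityʳ b
    abc⊆E∩P v (inj₂ (inj₂ refl)) = Ec , E⊆G c Ec , false ∷ false ∷ true ∷ [] , ⊕-identityʳ c

  sum₃-closed : Decidable E → ¬ HasInducedI3 E → Sum₃Closed E
  sum₃-closed E? no-I3 {a} {b} {c} Ea Eb Ec with a ≟ b | a ≟ c | b ≟ c
  ... | yes refl | _        | _        = subst E (sym (trans (cong (_⊕ c) (⊕-self a)) (⊕-identityˡ c))) Ec
  ... | no _     | yes refl | _        = subst E (sym (trans (cong (_⊕ a) (⊕-comm a b)) (⊕-cancelʳ b a))) Eb
  ... | no _     | no _     | yes refl = subst E (sym (⊕-cancelʳ a b)) Ea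
  ... | no a≢b   | no a≢c   | no b≢c with E? ((a ⊕ b) ⊕ c)
  ...   | yes Ea⊕b⊕c = Ea⊕b⊕c
  ...   | no ¬Ea⊕b⊕c = ⊥-elim (no-I3 (inducedI3 Ea Eb Ec a≢b a≢c b≢c ¬Ea⊕b⊕c))

corollary5p2 : (n : ℕ) (E : VSet n) → Decidable E → IsGroundSubset E →
    (∃ λ v → E v) →
    TriangleFree E → ¬ HasInducedI3 E →
    Σ (VSet n) λ F → IsClosure E F × IsAffineGeometry E F
corollary5p2 n E E? E⊆G (e₀ , Ee₀) triangle-free no-I3 =
  sum₃-closed⇒affine E? E⊆G (sum₃-closed E⊆G triangle-free E? no-I3) Ee₀
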